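{- Let $G$ be a graph in the support of $\mathcal{D}^{\mathrm{MIS}}_r$ ($r\ge1$), constructed from halves on $U$ and $V$ and relabelled by the permutation $\sigma$, and let $\Gamma$ be any maximal independent set of $G$. Then at least one of the following holds: (1) $\Gamma\cap\sigma(P[U])$ is a maximal independent set of the subgraph of $G$ induced on $\sigma(P[U])$; (2) $\Gamma\cap\sigma(P[V])$ is a maximal independent set of the subgraph of $G$ induced on $\sigma(P[V])$.
   Context: $\mathcal{D}^{\mathrm{MIS}}_0$: on $n_0=2k$ vertices, a fixed perfect matching with each edge dropped independently w.p. $1/2$. For $r\ge1$: $\hat f_r = k^6 n_{r-1}^3$, $\hat p_r = k^6 n_{r-1}^3\hat f_r$, $\hat n_r=(n_{r-1}-1)\hat f_r + n_{r-1}\hat p_r$. Half distribution on a set $W$ of size $\hat n_r$: partition $W$ into principal blocks $P_1,\dots,P_{\hat p_r}$ (size $n_{r-1}$) and fooling blocks $F_1,\dots,F_{\hat f_r}$ (size $n_{r-1}-1$); put an independent $\mathcal{D}^{\mathrm{MIS}}_{r-1}$ instance on each $P_i$; for each principal vertex $u$ and each $j$, sample an independent $\mathcal{D}^{\mathrm{MIS}}_{r-1}$ instance on $F_j\cup\{u\}$ and keep only edges incident to $u$. Write $P[W]=\bigcup_i P_i$ (principal vertices) and $F[W]=\bigcup_j F_j$ (fooling vertices). $\mathcal{D}^{\mathrm{MIS}}_r$: independent halves on disjoint $U,V$, plus all edges between $F[U]$ and $F[V]$, then relabel by a uniformly random permutation $\sigma$ of $U\cup V$; $n_r=2\hat n_r$.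 -}

module Defs where

open import Data.Nat using (ℕ; zero; suc; _+_; _*_; _∸_; _^_)
open import Data.Nat.DivMod using (_/_)
open import Data.Bool using (Bool; true; false; _∧_)
open import Data.Fin using (Fin; toℕ; _≟_)
open import Data.Fin.Subset using (Subset; _∈_; _⊆_; _∩_)
open import Data.Maybe using (Maybe; just; nothing)
open import Data.Product using (Σ; _×_; _,_)
open import Data.Sum using (_⊎_; inj₁; inj₂)
open import Data.Vec using (tabulate)
open import Function.Bundles using (_↔_; Inverse)
open import Relation.Binary.PropositionalEquality using (_≡_; refl)
open import Relation.Nullary using (¬_; yes; no)

Graph : ℕ → Set
Graph n = Fin n → Fin n → Bool

n : ℕ → ℕ → ℕ
-- f̂ , p̂ , n̂ at level r+1 from m = n_r
fhat : ℕ → ℕ → ℕ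
fhat k m = k ^ 6 * m ^ 3
phat : ℕ → ℕ → ℕ
phat k m = k ^ 6 * m ^ 3 * fhat k m
nhat : ℕ → ℕ → ℕ
nhat k m = (m ∸ 1) * fhat k m + m * phat k m

n k zero    = 2 * k
n k (suc r) = 2 * nhat k (n k r)

-- Level 0: the fixed perfect matching on Fin (2k) pairs 2i with 2i+1.

matched : ∀ {m} → Fin m → Fin m → Set
matched i j = (toℕ i / 2 ≡ toℕ j / 2) × ¬ (i ≡ j)

Supp0 : ∀ {m} → Graph m → Set
Supp0 G = (∀ i j → G i j ≡ G j i) × (∀ i j → G i j ≡ true → matched i j)

-- One half, at level r+1, with m = n_r, f = f̂, p = p̂, and S the
-- support predicate of D_r on Graph m.
-- Structured vertex set: principal vertices (i , a) with i : Fin p the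
-- block P_i and a : Fin m; fooling vertices (j , b) with j : Fin f the
-- block F_j and b : Fin (m ∸ 1).

HV : ℕ → ℕ → ℕ → Set
HV m f p = (Fin p × Fin m) ⊎ (Fin f × Fin (m ∸ 1))

record Half (m f p : ℕ) (S : Graph m → Set) : Set where
  field
    prin    : Fin p → Graph m
    prinOK  : ∀ i → S (prin i)
    -- for principal vertex u and fooling block F_j: a D_r instance on
    -- F_j ∪ {u}, identified with Fin m via a bijection (nothing = u)
    star    : Fin p × Fin m → Fin f → Graph m
    starOK  : ∀ u j → S (star u j)
    starLab : Fin p × Fin m → Fin f → Fin m ↔ Maybe (Fin (m ∸ 1))

  -- only edges incident to u are kept
  starEdge : Fin p × Fin m → Fin f → Fin (m ∸ 1) → Bool
  starEdge u j b = star u j (Inverse.from (starLab u j) nothing)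
                            (Inverse.from (starLab u j) (just b))

  edge : HV m f p → HV m f p → Bool
  edge (inj₁ (i , a)) (inj₁ (i' , a')) with i ≟ i'
  ... | yes refl = prin i a a'
  ... | no _     = false
  edge (inj₁ u) (inj₂ (j , b)) = starEdge u j b
  edge (inj₂ (j , b)) (inj₁ u) = starEdge u j b
  edge (inj₂ _) (inj₂ _) = false

-- Data of a D_{r+1} instance: halves on U (inj₁) and V (inj₂), and the
-- relabelling bijection σ onto Fin N (N = n_{r+1}).
record MISData (m f p N : ℕ) (S : Graph m → Set) : Set where
  field
    halfU : Half m f p S
    halfV : Half m f p S
    σ     : (HV m f p ⊎ HV m f p) ↔ Fin N

  edge : HV m f p ⊎ HV m f p → HV m f p ⊎ HV m f p → Bool
  edge (inj₁ x) (inj₁ y) = Half.edge halfU x y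
  edge (inj₂ x) (inj₂ y) = Half.edge halfV x y
  edge (inj₁ (inj₂ _)) (inj₂ (inj₂ _)) = true
  edge (inj₂ (inj₂ _)) (inj₁ (inj₂ _)) = true
  edge (inj₁ _) (inj₂ _) = false
  edge (inj₂ _) (inj₁ _) = false

  graph : Graph N
  graph x y = edge (Inverse.from σ x) (Inverse.from σ y)

  isPrinU : HV m f p ⊎ HV m f p → Bool
  isPrinU (inj₁ (inj₁ _)) = true
  isPrinU _ = false

  isPrinV : HV m f p ⊎ HV m f p → Bool
  isPrinV (inj₂ (inj₁ _)) = true
  isPrinV _ = false

  σPU : Subset N
  σPU = tabulate (λ x → isPrinU (Inverse.from σ x))

  σPV : Subset N
  σPV = tabulate (λ x → isPrinV (Inverse.from σ x))

Supp : (k r : ℕ) → Graph (n k r) → Set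

MISD : ℕ → ℕ → Set
MISD k r = MISData (n k r) (fhat k (n k r)) (phat k (n k r)) (n k (suc r)) (Supp k r)

Supp k zero    G = Supp0 G
Supp k (suc r) G = Σ (MISD k r) λ d → ∀ x y → G x y ≡ MISData.graph d x y

Independent : ∀ {N} → Graph N → Subset N → Set
Independent G Γ = ∀ x y → x ∈ Γ → y ∈ Γ → G x y ≡ false

IsMISIn : ∀ {N} → Graph N → Subset N → Subset N → Set
IsMISIn G S Γ = Γ ⊆ S × Independent G Γ
              × (∀ Δ → Δ ⊆ S → Independent G Δ → Γ ⊆ Δ → Δ ⊆ Γ)

IsMIS : ∀ {N} → Graph N → Subset N → Set
IsMIS G Γ = Independent G Γ × (∀ Δ → Independent G Δ → Γ ⊆ Δ → Δ ⊆ Γ)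

-- The fooling parts F[U] and F[V] are completely joined, so the
-- independent set Γ misses one of them, say F[U]. A vertex of P[U] is
-- adjacent only to vertices of P[U] ∪ F[U], hence every vertex of Γ outside
-- P[U] is non-adjacent to all of P[U]; for such a set S, maximality of Γ in
-- G passes to maximality of Γ ∩ S in the subgraph induced on S.

module Submission where

open import Defs
open import Data.Nat using (ℕ; suc)
open import Data.Fin.Subset using (Subset; _∩_)
open import Data.Sum using (_⊎_)

open import Data.Bool using (Bool; true; false)
open import Data.Bool.Properties using (¬-not) renaming (_≟_ to _≟ᵇ_)
open import Data.Empty using (⊥)
open import Data.Fin using (Fin)
open import Data.Fin.Properties using (any?)
open import Data.Fin.Subset using (_∈_; _∉_; _⊆_; _∪_; ⁅_⁆)
open import Data.Fin.Subset.Properties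
  using (x∈p∩q⁺; x∈p∩q⁻; x∈p∪q⁺; x∈p∪q⁻; x∈⁅x⁆; x∈⁅y⁆⇒x≡y; _∈?_)
open import Data.Product using (_×_; _,_; proj₁; proj₂)
open import Data.Sum using (inj₁; inj₂)
open import Data.Vec using (tabulate)
open import Data.Vec.Properties using ([]=⇒lookup; lookup⇒[]=; lookup∘tabulate)
open import Function using (_∘_)
open import Function.Bundles using (Inverse)
open import Relation.Binary.PropositionalEquality using (_≡_; refl; sym; trans)
open import Relation.Nullary using (yes; no)
open import Relation.Nullary.Decidable using (_×-dec_)

∈-tabulate⁻ : ∀ {N} {g : Fin N → Bool} {x} → x ∈ tabulate g → g x ≡ true
∈-tabulate⁻ {g = g} {x} x∈ = trans (sym (lookup∘tabulate g x)) ([]=⇒lookup x∈)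

∈-tabulate⁺ : ∀ {N} {g : Fin N → Bool} {x} → g x ≡ true → x ∈ tabulate g
∈-tabulate⁺ {g = g} {x} gx = lookup⇒[]= x (tabulate g) (trans (lookup∘tabulate g x) gx)

∉-tabulate⁻ : ∀ {N} {g : Fin N → Bool} {x} → x ∉ tabulate g → g x ≡ false
∉-tabulate⁻ x∉ = ¬-not (x∉ ∘ ∈-tabulate⁺)

module _ {N : ℕ} (G : Graph N) where

  Nonadjacent : Fin N → Fin N → Set
  Nonadjacent x y = G x y ≡ false × G y x ≡ false

  Independent-∪-⁅⁆ : ∀ {Γ x} → Independent G Γ → G x x ≡ false
                   → (∀ y → y ∈ Γ → Nonadjacent x y) → Independent G (Γ ∪ ⁅ x ⁆)
  Independent-∪-⁅⁆ {Γ} {x} indΓ loopless sep a b a∈ b∈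
    with x∈p∪q⁻ Γ ⁅ x ⁆ a∈ | x∈p∪q⁻ Γ ⁅ x ⁆ b∈
  ... | inj₁ aΓ | inj₁ bΓ = indΓ a b aΓ bΓ
  ... | inj₂ a≡ | inj₁ bΓ rewrite x∈⁅y⁆⇒x≡y x a≡ = proj₁ (sep b bΓ)
  ... | inj₁ aΓ | inj₂ b≡ rewrite x∈⁅y⁆⇒x≡y x b≡ = proj₂ (sep a aΓ)
  ... | inj₂ a≡ | inj₂ b≡ rewrite x∈⁅y⁆⇒x≡y x a≡ | x∈⁅y⁆⇒x≡y x b≡ = loopless

  IsMIS-absorbs-nonadjacent : ∀ {Γ x} → IsMIS G Γ → G x x ≡ false
                            → (∀ y → y ∈ Γ → Nonadjacent x y) → x ∈ Γ
  IsMIS-absorbs-nonadjacent {Γ} {x} (indΓ , maxΓ) loopless sep =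
    maxΓ (Γ ∪ ⁅ x ⁆) (Independent-∪-⁅⁆ indΓ loopless sep)
         (x∈p∪q⁺ ∘ inj₁) (x∈p∪q⁺ (inj₂ (x∈⁅x⁆ x)))

  IsMIS⇒IsMISIn-∩ : ∀ {Γ S} → IsMIS G Γ
                  → (∀ x y → x ∈ S → y ∈ Γ → y ∉ S → Nonadjacent x y)
                  → IsMISIn G S (Γ ∩ S)
  IsMIS⇒IsMISIn-∩ {Γ} {S} mis@(indΓ , _) outside-nonadjacent =
      proj₂ ∘ x∈p∩q⁻ Γ S
    , (λ x y x∈ y∈ → indΓ x y (proj₁ (x∈p∩q⁻ Γ S x∈)) (proj₁ (x∈p∩q⁻ Γ S y∈)))
    , maximal
    where
    maximal : ∀ Δ → Δ ⊆ S → Independent G Δ → Γ ∩ S ⊆ Δ → Δ ⊆ Γ ∩ S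
    maximal Δ Δ⊆S indΔ Γ∩S⊆Δ {x} x∈Δ =
      x∈p∩q⁺ (IsMIS-absorbs-nonadjacent mis (indΔ x x x∈Δ x∈Δ) sep , Δ⊆S x∈Δ)
      where
      sep : ∀ y → y ∈ Γ → Nonadjacent x y
      sep y y∈Γ with y ∈? S
      ... | yes y∈S = let y∈Δ = Γ∩S⊆Δ (x∈p∩q⁺ (y∈Γ , y∈S))
                      in indΔ x y x∈Δ y∈Δ , indΔ y x y∈Δ x∈Δ
      ... | no y∉S = outside-nonadjacent x y (Δ⊆S x∈Δ) y∈Γ y∉S

module _ {m f p N : ℕ} {S : Graph m → Set} (d : MISData m f p N S) where
  open MISData d

  isFoolU : HV m f p ⊎ HV m f p → Bool
  isFoolU (inj₁ (inj₂ _)) = true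
  isFoolU _               = false

  isFoolV : HV m f p ⊎ HV m f p → Bool
  isFoolV (inj₂ (inj₂ _)) = true
  isFoolV _               = false

  fooling-complete : ∀ a b → isFoolU a ≡ true → isFoolV b ≡ true → edge a b ≡ true
  fooling-complete (inj₁ (inj₂ _)) (inj₂ (inj₂ _)) _ _ = refl

  principalU-isolated : ∀ a b → isPrinU a ≡ true → isPrinU b ≡ false → isFoolU b ≡ false
                      → edge a b ≡ false × edge b a ≡ false
  principalU-isolated (inj₁ (inj₁ _)) (inj₂ (inj₁ _)) _ _ _ = refl , refl
  principalU-isolated (inj₁ (inj₁ _)) (inj₂ (inj₂ _)) _ _ _ = refl , refl
  principalU-isolated (inj₁ (inj₁ _)) (inj₁ (inj₁ _)) _ () _
  principalU-isolated (inj₁ (inj₁ _)) (inj₁ (inj₂ _)) _ _ ()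

  principalV-isolated : ∀ a b → isPrinV a ≡ true → isPrinV b ≡ false → isFoolV b ≡ false
                      → edge a b ≡ false × edge b a ≡ false
  principalV-isolated (inj₂ (inj₁ _)) (inj₁ (inj₁ _)) _ _ _ = refl , refl
  principalV-isolated (inj₂ (inj₁ _)) (inj₁ (inj₂ _)) _ _ _ = refl , refl
  principalV-isolated (inj₂ (inj₁ _)) (inj₂ (inj₁ _)) _ () _
  principalV-isolated (inj₂ (inj₁ _)) (inj₂ (inj₂ _)) _ _ ()

  private
    from : Fin N → HV m f p ⊎ HV m f p
    from = Inverse.from σ

  Avoids : (HV m f p ⊎ HV m f p → Bool) → Subset N → Set
  Avoids part Γ = ∀ y → y ∈ Γ → part (from y) ≡ false

  independent-avoids-fooling : ∀ {Γ} → Independent graph Γ → Avoids isFoolU Γ ⊎ Avoids isFoolV Γ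
  independent-avoids-fooling {Γ} indΓ
    with any? (λ x → (x ∈? Γ) ×-dec (isFoolU (from x) ≟ᵇ true))
  ... | yes (z , z∈Γ , z∈FU) = inj₂ λ y y∈Γ →
          ¬-not λ y∈FV → true≢false (trans (sym (fooling-complete (from z) (from y) z∈FU y∈FV))
                                              (indΓ z y z∈Γ y∈Γ))
    where
    true≢false : true ≡ false → ⊥
    true≢false ()
  ... | no ∄z = inj₁ λ y y∈Γ → ¬-not λ y∈FU → ∄z (y , y∈Γ , y∈FU)

  principalU-separated : ∀ {Γ} → Avoids isFoolU Γ
                       → ∀ x y → x ∈ σPU → y ∈ Γ → y ∉ σPU → Nonadjacent graph x y
  principalU-separated avoid x y x∈ y∈Γ y∉ =
    principalU-isolated (from x) (from y) (∈-tabulate⁻ x∈) (∉-tabulate⁻ y∉) (avoid y y∈Γ)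

  principalV-separated : ∀ {Γ} → Avoids isFoolV Γ
                       → ∀ x y → x ∈ σPV → y ∈ Γ → y ∉ σPV → Nonadjacent graph x y
  principalV-separated avoid x y x∈ y∈Γ y∉ =
    principalV-isolated (from x) (from y) (∈-tabulate⁻ x∈) (∉-tabulate⁻ y∉) (avoid y y∈Γ)

claim4p3 : (k r : ℕ) (d : MISD k r) (Γ : Subset (n k (suc r)))
         → IsMIS (MISData.graph d) Γ
         → IsMISIn (MISData.graph d) (MISData.σPU d) (Γ ∩ MISData.σPU d)
           ⊎ IsMISIn (MISData.graph d) (MISData.σPV d) (Γ ∩ MISData.σPV d)
claim4p3 k r d Γ mis with independent-avoids-fooling d (proj₁ mis)
... | inj₁ avoidsFU = inj₁ (IsMIS⇒IsMISIn-∩ _ mis (principalU-separated d avoidsFU))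
... | inj₂ avoidsFV = inj₂ (IsMIS⇒IsMISIn-∩ _ mis (principalV-separated d avoidsFV))
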